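{- Let $r\ge1$ and let $n_1,\dots,n_r$ be non-negative integers. 1) If $n_1+\dots+n_r\ge3$, or $r=2$ and $n_1=n_2=1$, then the sequence $\{M(n_1,\dots,n_r,m)\}_{m=0}^\infty$ is strictly increasing. 2) If $n_1+\dots+n_r\ge3$, or $r=2$ and $n_1=n_2=1$, then for every $k$ with $1\le k\le r+1$ the sequence $\{V_k(n_1,\dots,n_r,m)\}_{m=0}^\infty$ is strictly increasing.
   Context: For non-negative integers $n_1,\dots,n_s$ with $n=n_1+\dots+n_s\ge1$, define $$M(n_1,\dots,n_s)=\frac1n\sum_{d\mid\gcd(n_1,\dots,n_s)}\mu(d)\frac{(n/d)!}{(n_1/d)!\cdots(n_s/d)!},$$ where $\mu$ is the Möbius function (and $\gcd$ with zero entries ignores zeros, e.g. $\gcd(a,0)=a$); this is the number of aperiodic circular words of length $n$ in which letter $x_i$ occurs exactly $n_i$ times. For $1\le k\le s$ put $t_k=n_1+\dots+n_k$ and $$V_k(n_1,\dots,n_s)=\frac{(-1)^{t_k}}{n}\sum_{d\mid\gcd(n_1,\dots,n_s)}\mu(d)(-1)^{t_k/d}\frac{(n/d)!}{(n_1/d)!\cdots(n_s/d)!}.$$ -}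

module Defs where

open import Data.Nat as ℕ using (ℕ; zero; suc; _≤_; NonZero)
open import Data.Nat.Properties using (m*n≢0; _!≢0)
open import Data.Nat.Base using (_!)
open import Data.Nat.DivMod using (_/_)
open import Data.Nat.Divisibility using (_∣_; _∣?_)
open import Data.Nat.GCD using (gcd)
open import Data.Nat.Primality using (prime?)
open import Data.Integer as ℤ using (ℤ; +_)
open import Data.Rational as ℚ using (ℚ; 0ℚ; 1ℚ; -_)
open import Data.List using (List; []; _∷_; map; foldr; take; upTo; filter; length)
open import Data.Nat.ListAction using (sum)
open import Data.Bool.ListAction using (and)
open import Data.Bool using (Bool; true; false; if_then_else_; not)
open import Relation.Nullary.Decidable using (does; ¬?)

gcdL : List ℕ → ℕ
gcdL = foldr gcd 0

-- Möbius function: μ(d) = (-1)^k if d is squarefree with k distinct prime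
-- factors, and μ(d) = 0 otherwise.  (μ 0 is irrelevant; never used.)
primeDivisors : ℕ → List ℕ
primeDivisors d = filter prime? (filter (_∣? d) (upTo (suc d)))

squarefree : ℕ → Bool
squarefree d = and (map (λ k → not (does ((suc (suc k) ℕ.* suc (suc k)) ∣? d))) (upTo d))

neg1^ : ℕ → ℚ
neg1^ zero = 1ℚ
neg1^ (suc j) = - neg1^ j

μ : ℕ → ℚ
μ d = if squarefree d then neg1^ (length (primeDivisors d)) else 0ℚ

prodFact : List ℕ → ℕ
prodFact [] = 1
prodFact (a ∷ as) = a ! ℕ.* prodFact as

prodFact≢0 : (as : List ℕ) → NonZero (prodFact as)
prodFact≢0 [] = _
prodFact≢0 (a ∷ as) = m*n≢0 (a !) (prodFact as) {{a !≢0}} {{prodFact≢0 as}}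

multiTerm : List ℕ → (d : ℕ) → .{{NonZero d}} → ℚ
multiTerm ns d = ((+ ((sum ns / d) !)) ℚ./ prodFact (map (λ a → a / d) ns)) {{prodFact≢0 (map (λ a → a / d) ns)}}

divSum : ℕ → ((d : ℕ) → .{{NonZero d}} → ℚ) → ℚ
divSum g f = foldr ℚ._+_ 0ℚ (map (λ k → if does (suc k ∣? g) then f (suc k) else 0ℚ) (upTo g))

-- M(n_1,…,n_s) = (1/n) Σ_{d ∣ gcd} μ(d) (n/d)!/∏(n_i/d)!
M : List ℕ → ℚ
M ns = (+ 1 ℚ./ suc (sum ns ℕ.∸ 1)) ℚ.* divSum (gcdL ns) (λ d → μ d ℚ.* multiTerm ns d)

-- V_k(n_1,…,n_s) = ((-1)^{t_k}/n) Σ_{d ∣ gcd} μ(d) (-1)^{t_k/d} (n/d)!/∏(n_i/d)!,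
-- t_k = n_1 + ⋯ + n_k
V : ℕ → List ℕ → ℚ
V k ns = (neg1^ t ℚ.* (+ 1 ℚ./ suc (sum ns ℕ.∸ 1)))
           ℚ.* divSum (gcdL ns) (λ d → μ d ℚ.* neg1^ (t / d) ℚ.* multiTerm ns d)
  where t = sum (take k ns)

StrictlyIncreasing : (ℕ → ℚ) → Set
StrictlyIncreasing f = ∀ m → f m ℚ.< f (suc m)

module Submission where

-- Write the multiplicities as a list L with N = sum L ≥ 1, and let X m = C(N + m, m) · multinomial L be the
-- multinomial coefficient of L ∷ʳ m. In the divisor sums defining M (L ∷ʳ m) and V k (L ∷ʳ m), the divisor
-- d = 1 contributes ± X m, while each divisor d ≥ 2 contributes at most X m / p m in absolute value, where
-- p m = C(⌈N/2⌉ + ⌈m/2⌉, ⌈m/2⌉), because binomial coefficients are supermultiplicative. The gcd g has at most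
-- c m = g - 2 such divisors (g - 1 is never one), so for every k both sequences lie in
-- [X m (1 - c m / p m), X m (1 + c m / p m)] / (N + m). Since X (m + 1) (m + 1) = X m (N + m + 1), consecutive
-- intervals are disjoint once a polynomial inequality in N, m, c m, c (m + 1), p m, p (m + 1) holds. It follows
-- from growth estimates when N ≥ 13 or m ≥ 19, directly when m = 0, by evaluation in the finitely many
-- remaining cases with N ≥ 3, and trivially for L = (1, 1), where every gcd is 1.

module Binomial where

  open import Data.Nat
  open import Data.Nat.Properties
  open import Data.Nat.Tactic.RingSolver using (solve-∀)
  open import Relation.Binary.PropositionalEquality

  -- binom x y = C(x + y, x), in the two-index Pascal form that makes the inductions below structural.
  binom : ℕ → ℕ → ℕ
  binom zero    y       = 1
  binom (suc x) zero    = 1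
  binom (suc x) (suc y) = binom x (suc y) + binom (suc x) y

  binom-*-! : ∀ x y → binom x y * (x ! * y !) ≡ (x + y) !
  binom-*-! zero    y       = trans (+-identityʳ _) (*-identityˡ (y !))
  binom-*-! (suc x) zero    = trans (+-identityʳ _) (trans (*-identityʳ (suc x !)) (cong _! (sym (+-identityʳ (suc x)))))
  binom-*-! (suc x) (suc y) = begin
      (binom x (suc y) + binom (suc x) y) * (suc x ! * suc y !)
    ≡⟨ split (binom x (suc y)) (binom (suc x) y) x y (x !) (y !) ⟩
      suc x * (binom x (suc y) * (x ! * suc y !)) + suc y * (binom (suc x) y * (suc x ! * y !))
    ≡⟨ cong₂ (λ u v → suc x * u + suc y * v) (trans (binom-*-! x (suc y)) (cong _! (+-suc x y))) (binom-*-! (suc x) y) ⟩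
      suc x * suc (x + y) ! + suc y * suc (x + y) !
    ≡⟨ *-distribʳ-+ (suc (x + y) !) (suc x) (suc y) ⟨
      (suc x + suc y) * suc (x + y) !
    ≡⟨ cong (λ z → (suc x + suc y) * z !) (+-suc x y) ⟨
      suc (x + suc y) !
    ∎
    where
    open ≡-Reasoning
    split : ∀ p q x y a b → (p + q) * ((suc x * a) * (suc y * b)) ≡ suc x * (p * (a * (suc y * b))) + suc y * (q * ((suc x * a) * b))
    split = solve-∀

  binom-0ʳ : ∀ x → binom x 0 ≡ 1
  binom-0ʳ zero    = refl
  binom-0ʳ (suc x) = refl

  binom-1ˡ : ∀ y → binom 1 y ≡ suc y
  binom-1ˡ zero    = refl
  binom-1ˡ (suc y) = cong suc (binom-1ˡ y)

  2*binom-2ˡ : ∀ y → 2 * binom 2 y ≡ suc y * suc (suc y)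
  2*binom-2ˡ zero    = refl
  2*binom-2ˡ (suc y) = begin
      2 * (binom 1 (suc y) + binom 2 y)  ≡⟨ *-distribˡ-+ 2 (binom 1 (suc y)) (binom 2 y) ⟩
      2 * binom 1 (suc y) + 2 * binom 2 y ≡⟨ cong₂ (λ u v → 2 * u + v) (binom-1ˡ (suc y)) (2*binom-2ˡ y) ⟩
      2 * suc (suc y) + suc y * suc (suc y) ≡⟨ factor y ⟩
      suc (suc y) * suc (suc (suc y))     ∎
    where
    open ≡-Reasoning
    factor : ∀ y → 2 * suc (suc y) + suc y * suc (suc y) ≡ suc (suc y) * suc (suc (suc y))
    factor = solve-∀

  binom-sucʳ : ∀ x y → binom x (suc y) * suc y ≡ suc (x + y) * binom x y
  binom-sucʳ x y = *-cancelʳ-≡ _ _ (x ! * y !) {{x !* y !≢0}} (begin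
      binom x (suc y) * suc y * (x ! * y !)   ≡⟨ regroup (binom x (suc y)) y (x !) (y !) ⟩
      binom x (suc y) * (x ! * suc y !)       ≡⟨ binom-*-! x (suc y) ⟩
      (x + suc y) !                           ≡⟨ cong _! (+-suc x y) ⟩
      suc (x + y) * (x + y) !                 ≡⟨ cong (suc (x + y) *_) (binom-*-! x y) ⟨
      suc (x + y) * (binom x y * (x ! * y !)) ≡⟨ *-assoc (suc (x + y)) (binom x y) _ ⟨
      suc (x + y) * binom x y * (x ! * y !)   ∎)
    where
    open ≡-Reasoning
    regroup : ∀ p y a b → p * suc y * (a * b) ≡ p * (a * (suc y * b))
    regroup = solve-∀

  binom-pos : ∀ x y → 1 ≤ binom x y
  binom-pos zero    y       = ≤-refl
  binom-pos (suc x) zero    = ≤-refl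
  binom-pos (suc x) (suc y) = ≤-trans (binom-pos x (suc y)) (m≤m+n _ _)

  1+x*y≤binom : ∀ x y → 1 + x * y ≤ binom x y
  1+x*y≤binom zero    y       = ≤-refl
  1+x*y≤binom (suc x) zero    = ≤-reflexive (cong suc (*-zeroʳ x))
  1+x*y≤binom (suc x) (suc y) = begin
    1 + suc x * suc y                       ≤⟨ m≤m+n _ (x * y) ⟩
    1 + suc x * suc y + x * y               ≡⟨ regroup x y ⟩
    (1 + x * suc y) + (1 + suc x * y)       ≤⟨ +-mono-≤ (1+x*y≤binom x (suc y)) (1+x*y≤binom (suc x) y) ⟩
    binom x (suc y) + binom (suc x) y       ∎
    where
    open ≤-Reasoning
    regroup : ∀ x y → 1 + suc x * suc y + x * y ≡ (1 + x * suc y) + (1 + suc x * y)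
    regroup = solve-∀

  binom-sucˡ-≤ : ∀ x y → binom x y ≤ binom (suc x) y
  binom-sucˡ-≤ x zero    = ≤-reflexive (binom-0ʳ x)
  binom-sucˡ-≤ x (suc y) = m≤m+n _ _

  binom-sucʳ-≤ : ∀ x y → binom x y ≤ binom x (suc y)
  binom-sucʳ-≤ zero    y = ≤-refl
  binom-sucʳ-≤ (suc x) y = m≤n+m _ _

  step-mono-≤ : (f : ℕ → ℕ) → (∀ n → f n ≤ f (suc n)) → ∀ {m n} → m ≤ n → f m ≤ f n
  step-mono-≤ f step m≤n = go (≤⇒≤′ m≤n)
    where
    go : ∀ {m n} → m ≤′ n → f m ≤ f n
    go ≤′-refl        = ≤-refl
    go (≤′-step m≤′n) = ≤-trans (go m≤′n) (step _)

  binom-mono-≤ : ∀ {x x′ y y′} → x ≤ x′ → y ≤ y′ → binom x y ≤ binom x′ y′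
  binom-mono-≤ {x} {x′} {y} x≤x′ y≤y′ =
    ≤-trans (step-mono-≤ (λ z → binom z y) (λ z → binom-sucˡ-≤ z y) x≤x′)
            (step-mono-≤ (binom x′) (binom-sucʳ-≤ x′) y≤y′)

  binom-supermultiplicative : ∀ a b c d → binom a b * binom c d ≤ binom (a + c) (b + d)
  binom-supermultiplicative a b zero d = begin
    binom a b * 1             ≡⟨ *-identityʳ _ ⟩
    binom a b                 ≤⟨ binom-mono-≤ (m≤m+n a 0) (m≤m+n b d) ⟩
    binom (a + 0) (b + d)     ∎
    where open ≤-Reasoning
  binom-supermultiplicative a b (suc c) zero = begin
    binom a b * 1             ≡⟨ *-identityʳ _ ⟩
    binom a b                 ≤⟨ binom-mono-≤ (m≤m+n a (suc c)) (m≤m+n b 0) ⟩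
    binom (a + suc c) (b + 0) ∎
    where open ≤-Reasoning
  binom-supermultiplicative a b (suc c) (suc d) = begin
    binom a b * (binom c (suc d) + binom (suc c) d)
      ≡⟨ *-distribˡ-+ (binom a b) _ _ ⟩
    binom a b * binom c (suc d) + binom a b * binom (suc c) d
      ≤⟨ +-mono-≤ (binom-supermultiplicative a b c (suc d)) (binom-supermultiplicative a b (suc c) d) ⟩
    binom (a + c) (b + suc d) + binom (a + suc c) (b + d)
      ≡⟨ cong₂ _+_ (cong (binom (a + c)) (+-suc b d)) (cong (λ z → binom z (b + d)) (+-suc a c)) ⟩
    binom (suc (a + c)) (suc (b + d))
      ≡⟨ cong₂ binom (+-suc a c) (+-suc b d) ⟨
    binom (a + suc c) (b + suc d)
      ∎
    where open ≤-Reasoning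

module Multinomial where

  open import Data.Nat
  open import Data.Nat.Properties
  open import Data.Nat.Tactic.RingSolver using (solve-∀)
  open import Data.Nat.DivMod using (_/_; m/n≤m)
  open import Data.List using (List; []; _∷_; _∷ʳ_; map)
  open import Data.Nat.ListAction using (sum)
  open import Data.Nat.ListAction.Properties using (sum-++)
  open import Relation.Binary.PropositionalEquality
  open import Defs using (prodFact; prodFact≢0)
  open Binomial

  multinomial : List ℕ → ℕ
  multinomial []       = 1
  multinomial (x ∷ xs) = binom x (sum xs) * multinomial xs

  multinomial-*-prodFact : ∀ xs → multinomial xs * prodFact xs ≡ sum xs !
  multinomial-*-prodFact []       = refl
  multinomial-*-prodFact (x ∷ xs) = begin
    binom x (sum xs) * multinomial xs * (x ! * prodFact xs) ≡⟨ regroup (binom x (sum xs)) (multinomial xs) (x !) (prodFact xs) ⟩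
    binom x (sum xs) * (x ! * (multinomial xs * prodFact xs)) ≡⟨ cong (λ z → binom x (sum xs) * (x ! * z)) (multinomial-*-prodFact xs) ⟩
    binom x (sum xs) * (x ! * sum xs !)                     ≡⟨ binom-*-! x (sum xs) ⟩
    (x + sum xs) !                                          ∎
    where
    open ≡-Reasoning
    regroup : ∀ p f a q → p * f * (a * q) ≡ p * (a * (f * q))
    regroup = solve-∀

  prodFact-∷ʳ : ∀ xs y → prodFact (xs ∷ʳ y) ≡ prodFact xs * y !
  prodFact-∷ʳ []       y = trans (*-identityʳ (y !)) (sym (+-identityʳ (y !)))
  prodFact-∷ʳ (x ∷ xs) y = trans (cong (x ! *_) (prodFact-∷ʳ xs y)) (sym (*-assoc (x !) (prodFact xs) (y !)))

  multinomial-∷ʳ : ∀ xs y → multinomial (xs ∷ʳ y) ≡ binom (sum xs) y * multinomial xs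
  multinomial-∷ʳ xs y = *-cancelʳ-≡ _ _ (prodFact xs * y !) {{m*n≢0 _ _ {{prodFact≢0 xs}} {{y !≢0}}}} (begin
    multinomial (xs ∷ʳ y) * (prodFact xs * y !)          ≡⟨ cong (multinomial (xs ∷ʳ y) *_) (prodFact-∷ʳ xs y) ⟨
    multinomial (xs ∷ʳ y) * prodFact (xs ∷ʳ y)           ≡⟨ multinomial-*-prodFact (xs ∷ʳ y) ⟩
    sum (xs ∷ʳ y) !                                      ≡⟨ cong _! (trans (sum-++ xs (y ∷ [])) (cong (sum xs +_) (+-identityʳ y))) ⟩
    (sum xs + y) !                                       ≡⟨ binom-*-! (sum xs) y ⟨
    binom (sum xs) y * (sum xs ! * y !)                  ≡⟨ cong (λ z → binom (sum xs) y * (z * y !)) (multinomial-*-prodFact xs) ⟨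
    binom (sum xs) y * (multinomial xs * prodFact xs * y !) ≡⟨ regroup (binom (sum xs) y) (multinomial xs) (prodFact xs) (y !) ⟩
    binom (sum xs) y * multinomial xs * (prodFact xs * y !) ∎)
    where
    open ≡-Reasoning
    regroup : ∀ p f q b → p * (f * q * b) ≡ p * f * (q * b)
    regroup = solve-∀

  multinomial-pos : ∀ xs → 1 ≤ multinomial xs
  multinomial-pos []       = ≤-refl
  multinomial-pos (x ∷ xs) = *-mono-≤ (binom-pos x (sum xs)) (multinomial-pos xs)

  sum-map-/-≤ : ∀ xs d .{{_ : NonZero d}} → sum (map (_/ d) xs) ≤ sum xs
  sum-map-/-≤ []       d = ≤-refl
  sum-map-/-≤ (x ∷ xs) d = +-mono-≤ (m/n≤m x d) (sum-map-/-≤ xs d)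

  multinomial-map-/-≤ : ∀ xs d .{{_ : NonZero d}} → multinomial (map (_/ d) xs) ≤ multinomial xs
  multinomial-map-/-≤ []       d = ≤-refl
  multinomial-map-/-≤ (x ∷ xs) d = *-mono-≤ (binom-mono-≤ (m/n≤m x d) (sum-map-/-≤ xs d)) (multinomial-map-/-≤ xs d)

module Fraction where

  open import Data.Nat as ℕ using (ℕ; suc; NonZero)
  import Data.Nat.Properties as ℕ
  open import Data.Nat.Tactic.RingSolver using (solve-∀)
  open import Data.Integer as ℤ using (+_)
  import Data.Integer.Properties as ℤ
  open import Data.Rational as ℚ using (ℚ; 0ℚ; 1ℚ; _/_; toℚᵘ; _+_; _*_; _≤_; _<_)
  import Data.Rational.Properties as ℚ
  open import Data.Rational.Unnormalised as ℚᵘ using (mkℚᵘ; *≡*; *≤*; *<*)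
  import Data.Rational.Unnormalised.Properties as ℚᵘ
  open import Relation.Binary.PropositionalEquality

  frac : ℕ → (b : ℕ) → .{{NonZero b}} → ℚ
  frac a b = + a / b

  private
    toℚᵘ-frac : ∀ a b → toℚᵘ (frac a (suc b)) ℚᵘ.≃ mkℚᵘ (+ a) b
    toℚᵘ-frac a b = ℚ.toℚᵘ-fromℚᵘ (mkℚᵘ (+ a) b)

  frac-cong : ∀ a b c d .{{_ : NonZero b}} .{{_ : NonZero d}} → a ℕ.* d ≡ c ℕ.* b → frac a b ≡ frac c d
  frac-cong a (suc b) c (suc d) eq = ℚ.toℚᵘ-injective (begin
    toℚᵘ (frac a (suc b)) ≈⟨ toℚᵘ-frac a b ⟩
    mkℚᵘ (+ a) b          ≈⟨ *≡* (trans (sym (ℤ.pos-* a (suc d))) (trans (cong +_ eq) (ℤ.pos-* c (suc b)))) ⟩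
    mkℚᵘ (+ c) d          ≈⟨ toℚᵘ-frac c d ⟨
    toℚᵘ (frac c (suc d)) ∎)
    where open ℚᵘ.≃-Reasoning

  frac-mono-≤ : ∀ a b c d .{{_ : NonZero b}} .{{_ : NonZero d}} → a ℕ.* d ℕ.≤ c ℕ.* b → frac a b ≤ frac c d
  frac-mono-≤ a (suc b) c (suc d) le = ℚ.toℚᵘ-cancel-≤ (begin
    toℚᵘ (frac a (suc b)) ≃⟨ toℚᵘ-frac a b ⟩
    mkℚᵘ (+ a) b          ≤⟨ *≤* (subst₂ ℤ._≤_ (ℤ.pos-* a (suc d)) (ℤ.pos-* c (suc b)) (ℤ.+≤+ le)) ⟩
    mkℚᵘ (+ c) d          ≃⟨ toℚᵘ-frac c d ⟨
    toℚᵘ (frac c (suc d)) ∎)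
    where open ℚᵘ.≤-Reasoning

  frac-mono-< : ∀ a b c d .{{_ : NonZero b}} .{{_ : NonZero d}} → a ℕ.* d ℕ.< c ℕ.* b → frac a b < frac c d
  frac-mono-< a (suc b) c (suc d) lt = ℚ.toℚᵘ-cancel-< (begin-strict
    toℚᵘ (frac a (suc b)) ≃⟨ toℚᵘ-frac a b ⟩
    mkℚᵘ (+ a) b          <⟨ *<* (subst₂ ℤ._<_ (ℤ.pos-* a (suc d)) (ℤ.pos-* c (suc b)) (ℤ.+<+ lt)) ⟩
    mkℚᵘ (+ c) d          ≃⟨ toℚᵘ-frac c d ⟨
    toℚᵘ (frac c (suc d)) ∎)
    where open ℚᵘ.≤-Reasoning

  frac-+ : ∀ a b c d .{{_ : NonZero b}} .{{_ : NonZero d}} → frac a b + frac c d ≡ frac (a ℕ.* d ℕ.+ c ℕ.* b) (b ℕ.* d) {{ℕ.m*n≢0 b d}}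
  frac-+ a (suc b) c (suc d) = ℚ.toℚᵘ-injective (begin
    toℚᵘ (frac a (suc b) + frac c (suc d))             ≈⟨ ℚ.toℚᵘ-homo-+ (frac a (suc b)) (frac c (suc d)) ⟩
    toℚᵘ (frac a (suc b)) ℚᵘ.+ toℚᵘ (frac c (suc d))   ≈⟨ ℚᵘ.+-cong (toℚᵘ-frac a b) (toℚᵘ-frac c d) ⟩
    mkℚᵘ (+ a) b ℚᵘ.+ mkℚᵘ (+ c) d                     ≡⟨ cong (λ z → mkℚᵘ z (d ℕ.+ b ℕ.* suc d)) numerator ⟩
    mkℚᵘ (+ (a ℕ.* suc d ℕ.+ c ℕ.* suc b)) (d ℕ.+ b ℕ.* suc d) ≈⟨ toℚᵘ-frac _ _ ⟨
    toℚᵘ (frac (a ℕ.* suc d ℕ.+ c ℕ.* suc b) (suc b ℕ.* suc d)) ∎)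
    where
    open ℚᵘ.≃-Reasoning
    numerator : + a ℤ.* + suc d ℤ.+ + c ℤ.* + suc b ≡ + (a ℕ.* suc d ℕ.+ c ℕ.* suc b)
    numerator = trans (cong₂ ℤ._+_ (sym (ℤ.pos-* a (suc d))) (sym (ℤ.pos-* c (suc b)))) (sym (ℤ.pos-+ (a ℕ.* suc d) (c ℕ.* suc b)))

  frac-* : ∀ a b c d .{{_ : NonZero b}} .{{_ : NonZero d}} → frac a b * frac c d ≡ frac (a ℕ.* c) (b ℕ.* d) {{ℕ.m*n≢0 b d}}
  frac-* a (suc b) c (suc d) = ℚ.toℚᵘ-injective (begin
    toℚᵘ (frac a (suc b) * frac c (suc d))             ≈⟨ ℚ.toℚᵘ-homo-* (frac a (suc b)) (frac c (suc d)) ⟩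
    toℚᵘ (frac a (suc b)) ℚᵘ.* toℚᵘ (frac c (suc d))   ≈⟨ ℚᵘ.*-cong (toℚᵘ-frac a b) (toℚᵘ-frac c d) ⟩
    mkℚᵘ (+ a) b ℚᵘ.* mkℚᵘ (+ c) d                     ≡⟨ cong (λ z → mkℚᵘ z (d ℕ.+ b ℕ.* suc d)) (ℤ.pos-* a c) ⟨
    mkℚᵘ (+ (a ℕ.* c)) (d ℕ.+ b ℕ.* suc d)             ≈⟨ toℚᵘ-frac _ _ ⟨
    toℚᵘ (frac (a ℕ.* c) (suc b ℕ.* suc d))            ∎)
    where open ℚᵘ.≃-Reasoning

  frac-nonNeg : ∀ a b .{{_ : NonZero b}} → 0ℚ ≤ frac a b
  frac-nonNeg a b = ℚ.nonNegative⁻¹ (frac a b) {{ℚ.normalize-nonNeg a b}}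

  frac-integer-* : ∀ a c d .{{_ : NonZero d}} → frac a 1 * frac c d ≡ frac (a ℕ.* c) d
  frac-integer-* a c d = trans (frac-* a 1 c d)
    (frac-cong (a ℕ.* c) (1 ℕ.* d) (a ℕ.* c) d {{ℕ.m*n≢0 1 d}} (cong (a ℕ.* c ℕ.*_) (sym (ℕ.*-identityˡ d))))

  frac-integer-+ : ∀ a c d .{{_ : NonZero d}} → frac a 1 + frac c d ≡ frac (a ℕ.* d ℕ.+ c) d
  frac-integer-+ a c d = trans (frac-+ a 1 c d)
    (frac-cong (a ℕ.* d ℕ.+ c ℕ.* 1) (1 ℕ.* d) (a ℕ.* d ℕ.+ c) d {{ℕ.m*n≢0 1 d}} (normalise a c d))
    where
    normalise : ∀ a c d → (a ℕ.* d ℕ.+ c ℕ.* 1) ℕ.* d ≡ (a ℕ.* d ℕ.+ c) ℕ.* (1 ℕ.* d)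
    normalise = solve-∀

  frac-unit-* : ∀ n a b .{{_ : NonZero n}} .{{_ : NonZero b}} → frac 1 n * frac a b ≡ frac a (n ℕ.* b) {{ℕ.m*n≢0 n b}}
  frac-unit-* n a b = trans (frac-* 1 n a b) (cong (λ z → frac z (n ℕ.* b) {{ℕ.m*n≢0 n b}}) (ℕ.*-identityˡ a))

  frac-suc : ∀ j → frac (suc j) 1 ≡ 1ℚ + frac j 1
  frac-suc j = sym (trans (frac-+ 1 1 j 1) (frac-cong (1 ℕ.* 1 ℕ.+ j ℕ.* 1) (1 ℕ.* 1) (suc j) 1 (normalise j)))
    where
    normalise : ∀ j → (1 ℕ.* 1 ℕ.+ j ℕ.* 1) ℕ.* 1 ≡ suc j ℕ.* (1 ℕ.* 1)
    normalise = solve-∀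

module DivisorSum where

  open import Data.Nat as ℕ using (ℕ; zero; suc; NonZero)
  import Data.Nat.Properties as ℕ
  open import Data.Nat.Divisibility using (_∣_; _∣?_; ∣m+n∣m⇒∣n; ∣-refl; 1∣_; ∣1⇒≡1)
  open import Data.Rational as ℚ using (ℚ; 0ℚ; 1ℚ; ∣_∣; _+_; _*_; _-_; _≤_)
  import Data.Rational.Properties as ℚ
  open import Data.Rational.Solver using (module +-*-Solver)
  open import Data.List using ([]; _∷_; _++_; map; foldr; applyUpTo)
  open import Data.List.Properties using (foldr-++; map-++)
  open import Data.Bool using (if_then_else_)
  open import Relation.Nullary using (¬_)
  open import Relation.Nullary.Decidable using (does; dec-true; dec-false; yes; no)
  open import Relation.Binary.PropositionalEquality
  open import Defs using (divSum)
  open Fraction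
  open +-*-Solver using (solve; _:+_; _:*_; _:-_; _:=_; con)

  Weight : Set
  Weight = (d : ℕ) → .{{NonZero d}} → ℚ

  -- An upper bound for the number of divisors d ≥ 2 of g: for g ≥ 3 they lie in 2..g but miss g - 1.
  divisorBound : ℕ → ℕ
  divisorBound 0                   = 0
  divisorBound 1                   = 0
  divisorBound 2                   = 1
  divisorBound (suc (suc (suc j))) = suc j

  ∣foldr-+-applyUpTo∣≤ : ∀ (h : ℕ → ℚ) (g : ℕ → ℕ) {B} j z → (∀ i → ∣ h (g i) ∣ ≤ B) →
                         ∣ foldr _+_ z (map h (applyUpTo g j)) ∣ ≤ frac j 1 * B + ∣ z ∣
  ∣foldr-+-applyUpTo∣≤ h g {B} zero    z _  = ℚ.≤-reflexive (sym (trans (cong (_+ ∣ z ∣) (ℚ.*-zeroˡ B)) (ℚ.+-identityˡ ∣ z ∣)))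
  ∣foldr-+-applyUpTo∣≤ h g {B} (suc j) z hB = begin
    ∣ h (g 0) + rest ∣          ≤⟨ ℚ.∣p+q∣≤∣p∣+∣q∣ (h (g 0)) rest ⟩
    ∣ h (g 0) ∣ + ∣ rest ∣      ≤⟨ ℚ.+-mono-≤ (hB 0) (∣foldr-+-applyUpTo∣≤ h (λ i → g (suc i)) j z (λ i → hB (suc i))) ⟩
    B + (frac j 1 * B + ∣ z ∣)  ≡⟨ collect B (frac j 1) ∣ z ∣ ⟩
    (1ℚ + frac j 1) * B + ∣ z ∣ ≡⟨ cong (λ w → w * B + ∣ z ∣) (frac-suc j) ⟨
    frac (suc j) 1 * B + ∣ z ∣  ∎
    where
    open ℚ.≤-Reasoning
    rest = foldr _+_ z (map h (applyUpTo (λ i → g (suc i)) j))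
    collect : ∀ b x y → b + (x * b + y) ≡ (1ℚ + x) * b + y
    collect = solve 3 (λ b x y → b :+ (x :* b :+ y) := (con 1ℚ :+ x) :* b :+ y) refl

  applyUpTo-++-last2 : ∀ (g : ℕ → ℕ) j → applyUpTo g (suc (suc j)) ≡ applyUpTo g j ++ g j ∷ g (suc j) ∷ []
  applyUpTo-++-last2 g zero    = refl
  applyUpTo-++-last2 g (suc j) = cong (g 0 ∷_) (applyUpTo-++-last2 (λ i → g (suc i)) j)

  2+j∤3+j : ∀ j → ¬ (suc (suc j) ∣ suc (suc (suc j)))
  2+j∤3+j j p with ∣1⇒≡1 (∣m+n∣m⇒∣n (subst (suc (suc j) ∣_) (ℕ.+-comm 1 (suc (suc j))) p) ∣-refl)
  ... | ()

  private module Tail (g : ℕ) (f : Weight) {B : ℚ} (0≤B : 0ℚ ≤ B) (hB : ∀ k → suc (suc k) ∣ suc g → ∣ f (suc (suc k)) ∣ ≤ B) where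

    term : ℕ → ℚ
    term k = if does (suc k ∣? suc g) then f (suc k) else 0ℚ

    term-suc-bound : ∀ i → ∣ term (suc i) ∣ ≤ B
    term-suc-bound i with suc (suc i) ∣? suc g
    ... | yes p rewrite dec-true  (suc (suc i) ∣? suc g) p = hB i p
    ... | no ¬p rewrite dec-false (suc (suc i) ∣? suc g) ¬p = 0≤B

    tail : ℕ → ℚ
    tail j = foldr _+_ 0ℚ (map term (applyUpTo suc j))

    tail-bound : ∀ j → j ≡ g → ∣ tail j ∣ ≤ frac (divisorBound (suc j)) 1 * B
    tail-bound zero _ = ℚ.≤-reflexive (sym (ℚ.*-zeroˡ B))
    tail-bound (suc zero) _ = ℚ.≤-trans (∣foldr-+-applyUpTo∣≤ term suc 1 0ℚ term-suc-bound) (ℚ.≤-reflexive (ℚ.+-identityʳ _))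
    tail-bound (suc (suc j)) refl = begin
      ∣ tail (suc (suc j)) ∣                   ≡⟨ cong ∣_∣ split-last2 ⟩
      ∣ foldr _+_ last2 (map term (applyUpTo suc j)) ∣
                                               ≤⟨ ∣foldr-+-applyUpTo∣≤ term suc j last2 term-suc-bound ⟩
      frac j 1 * B + ∣ last2 ∣                 ≤⟨ ℚ.+-monoʳ-≤ (frac j 1 * B) ∣last2∣≤B ⟩
      frac j 1 * B + B                         ≡⟨ collect (frac j 1) B ⟩
      (1ℚ + frac j 1) * B                      ≡⟨ cong (_* B) (frac-suc j) ⟨
      frac (suc j) 1 * B                       ∎
      where
      open ℚ.≤-Reasoning
      last2 = term (suc j) + (term (suc (suc j)) + 0ℚ)
      split-last2 : tail (suc (suc j)) ≡ foldr _+_ last2 (map term (applyUpTo suc j))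
      split-last2 = trans (cong (λ xs → foldr _+_ 0ℚ (map term xs)) (applyUpTo-++-last2 suc j))
                      (trans (cong (foldr _+_ 0ℚ) (map-++ term (applyUpTo suc j) _)) (foldr-++ _+_ 0ℚ (map term (applyUpTo suc j)) _))
      ∣last2∣≤B : ∣ last2 ∣ ≤ B
      ∣last2∣≤B = subst (λ w → ∣ w ∣ ≤ B) (sym last2≡) (term-suc-bound (suc j))
        where
        last2≡ : last2 ≡ term (suc (suc j))
        last2≡ rewrite dec-false (suc (suc j) ∣? suc g) (2+j∤3+j j) = trans (ℚ.+-identityˡ _) (ℚ.+-identityʳ _)
      collect : ∀ x b → x * b + b ≡ (1ℚ + x) * b
      collect = solve 2 (λ x b → x :* b :+ b := (con 1ℚ :+ x) :* b) refl

    divSum-suc-bound : ∣ divSum (suc g) f - f 1 ∣ ≤ frac (divisorBound (suc g)) 1 * B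
    divSum-suc-bound = subst (λ w → ∣ w ∣ ≤ frac (divisorBound (suc g)) 1 * B) (sym divSum-f1) (tail-bound g refl)
      where
      divSum-f1 : divSum (suc g) f - f 1 ≡ tail g
      divSum-f1 rewrite dec-true (1 ∣? suc g) (1∣ suc g) = cancel (f 1) (tail g)
        where
        cancel : ∀ a r → a + r - a ≡ r
        cancel = solve 2 (λ a r → a :+ r :- a := r) refl

  divSum-bound : ∀ g .{{_ : NonZero g}} (f : Weight) {B} → 0ℚ ≤ B → (∀ k → suc (suc k) ∣ g → ∣ f (suc (suc k)) ∣ ≤ B) →
                 ∣ divSum g f - f 1 ∣ ≤ frac (divisorBound g) 1 * B
  divSum-bound (suc g) f 0≤B hB = Tail.divSum-suc-bound g f 0≤B hB

module GapInequality where

  open import Data.Nat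
  open import Data.Nat.Properties
  open import Data.Nat.Tactic.RingSolver using (solve-∀)
  open import Data.Nat.DivMod using (_/_; m*n/n≡m; m/n≤m; m/n*n≤m; /-monoʳ-≤)
  open import Data.Nat.Divisibility using (∣⇒≤)
  open import Data.Nat.GCD using (gcd; gcd[m,n]∣m; gcd[m,n]∣n)
  open import Data.Bool using (Bool; T)
  open import Data.Bool.ListAction using (all)
  open import Data.List using (upTo)
  open import Data.List.Relation.Unary.All using (lookup)
  open import Data.List.Relation.Unary.All.Properties using (all⁺)
  open import Data.List.Membership.Propositional.Properties using (∈-upTo⁺)
  open import Relation.Nullary using (yes; no)
  open import Relation.Binary.PropositionalEquality
  open Binomial
  open DivisorSum using (divisorBound)

  upperHalf : ℕ → ℕ
  upperHalf n = n ∸ n / 2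

  n≤2*upperHalf : ∀ n → n ≤ 2 * upperHalf n
  n≤2*upperHalf n = begin
    n                           ≡⟨ m∸n+n≡m (m/n≤m n 2) ⟨
    upperHalf n + n / 2         ≤⟨ +-monoʳ-≤ (upperHalf n) lowerHalf≤upperHalf ⟩
    upperHalf n + upperHalf n   ≡⟨ cong (upperHalf n +_) (+-identityʳ (upperHalf n)) ⟨
    2 * upperHalf n             ∎
    where
    open ≤-Reasoning
    lowerHalf≤upperHalf : n / 2 ≤ upperHalf n
    lowerHalf≤upperHalf = ≤-trans (≤-reflexive (sym (m+n∸n≡m (n / 2) (n / 2))))
      (∸-monoˡ-≤ (n / 2) (≤-trans (≤-reflexive (trans (cong (n / 2 +_) (sym (+-identityʳ (n / 2)))) (*-comm 2 (n / 2)))) (m/n*n≤m n 2)))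

  upperHalf-> : ∀ {k n} → 2 * k < n → k < upperHalf n
  upperHalf-> {k} {n} 2k<n = *-cancelˡ-< 2 k (upperHalf n) (<-≤-trans 2k<n (n≤2*upperHalf n))

  halfBinom : ℕ → ℕ → ℕ
  halfBinom N m = binom (upperHalf N) (upperHalf m)

  halfBinom-nonZero : ∀ N m → NonZero (halfBinom N m)
  halfBinom-nonZero N m = >-nonZero (binom-pos (upperHalf N) (upperHalf m))

  binom-/-*-halfBinom≤binom : ∀ N m d .{{_ : NonZero d}} → 2 ≤ d → binom (N / d) (m / d) * halfBinom N m ≤ binom N m
  binom-/-*-halfBinom≤binom N m d 2≤d = begin
    binom (N / d) (m / d) * binom (N ∸ N / 2) (m ∸ m / 2)
      ≤⟨ *-monoʳ-≤ (binom (N / d) (m / d)) (binom-mono-≤ (∸-monoʳ-≤ N (/-monoʳ-≤ N 2≤d)) (∸-monoʳ-≤ m (/-monoʳ-≤ m 2≤d))) ⟩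
    binom (N / d) (m / d) * binom (N ∸ N / d) (m ∸ m / d)
      ≤⟨ binom-supermultiplicative (N / d) (m / d) (N ∸ N / d) (m ∸ m / d) ⟩
    binom (N / d + (N ∸ N / d)) (m / d + (m ∸ m / d))
      ≡⟨ cong₂ binom (m+[n∸m]≡n (m/n≤m N d)) (m+[n∸m]≡n (m/n≤m m d)) ⟩
    binom N m
      ∎
    where open ≤-Reasoning

  -- (X + c₁ X / p) / (N + m) < (Y - c₂ Y / q) / (N + m + 1) with denominators cleared,
  -- given X (N + m + 1) = Y (m + 1); see gap⇒cross-multiplied.
  Gap : (N m c₁ c₂ p q : ℕ) → Set
  Gap N m c₁ c₂ p q = suc m * c₁ * q + (N + m) * c₂ * p < pred N * (p * q)

  GapAt : (N m c₁ c₂ : ℕ) → Set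
  GapAt N m c₁ c₂ = Gap N m c₁ c₂ (halfBinom N m) (halfBinom N (suc m))

  GapAt-anti : ∀ N m {c₁ c₂ c₁′ c₂′} → c₁ ≤ c₁′ → c₂ ≤ c₂′ → GapAt N m c₁′ c₂′ → GapAt N m c₁ c₂
  GapAt-anti N m c₁≤c₁′ c₂≤c₂′ =
    ≤-<-trans (+-mono-≤ (*-monoˡ-≤ (halfBinom N (suc m)) (*-monoʳ-≤ (suc m) c₁≤c₁′))
                        (*-monoˡ-≤ (halfBinom N m) (*-monoʳ-≤ (N + m) c₂≤c₂′)))

  gap⇒cross-multiplied : ∀ {N m c₁ c₂ p q X Y} → 1 ≤ N → 1 ≤ Y → X * suc (N + m) ≡ Y * suc m →
    Gap N m c₁ c₂ p q →
    let n = N + m in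
    (X * (p + c₁) * (suc n * q) + c₂ * Y * (n * p)) * suc n < Y * ((n * p) * (suc n * q))
  gap⇒cross-multiplied {suc N′} {m} {c₁} {c₂} {p} {q} {X} {Y} _ 1≤Y Xn′≡Ym′ gap = begin-strict
    (X * (p + c₁) * (n′ * q) + c₂ * Y * (n * p)) * n′
      ≡⟨ regroup X p c₁ n′ q c₂ Y n ⟩
    n′ * ((X * n′) * (p + c₁) * q + c₂ * Y * n * p)
      ≡⟨ cong (λ z → n′ * (z * (p + c₁) * q + c₂ * Y * n * p)) Xn′≡Ym′ ⟩
    n′ * ((Y * suc m) * (p + c₁) * q + c₂ * Y * n * p)
      ≡⟨ regroup′ n′ Y (suc m) p c₁ q c₂ n ⟩
    n′ * (Y * (suc m * p * q + (suc m * c₁ * q + n * c₂ * p)))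
      <⟨ *-monoʳ-< n′ (*-monoʳ-< Y {{>-nonZero 1≤Y}} (+-monoʳ-< (suc m * p * q) gap)) ⟩
    n′ * (Y * (suc m * p * q + N′ * (p * q)))
      ≡⟨ regroup″ n′ Y m p q N′ ⟩
    Y * ((n * p) * (n′ * q))
      ∎
    where
    open ≤-Reasoning
    n = suc N′ + m
    n′ = suc n
    regroup : ∀ X p c₁ n′ q c₂ Y n → (X * (p + c₁) * (n′ * q) + c₂ * Y * (n * p)) * n′ ≡ n′ * ((X * n′) * (p + c₁) * q + c₂ * Y * n * p)
    regroup = solve-∀
    regroup′ : ∀ n′ Y m′ p c₁ q c₂ n → n′ * ((Y * m′) * (p + c₁) * q + c₂ * Y * n * p) ≡ n′ * (Y * (m′ * p * q + (m′ * c₁ * q + n * c₂ * p)))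
    regroup′ = solve-∀
    regroup″ : ∀ n′ Y m p q N′ → n′ * (Y * (suc m * p * q + N′ * (p * q))) ≡ Y * (((suc N′ + m) * p) * (n′ * q))
    regroup″ = solve-∀

  divisorBound-≤ : ∀ g → divisorBound g ≤ pred g
  divisorBound-≤ 0                   = z≤n
  divisorBound-≤ 1                   = z≤n
  divisorBound-≤ 2                   = ≤-refl
  divisorBound-≤ (suc (suc (suc j))) = n≤1+n (suc j)

  divisorBound-mono : ∀ {a b} → a ≤ b → divisorBound a ≤ divisorBound b
  divisorBound-mono {0}                 _                   = z≤n
  divisorBound-mono {1}                 _                   = z≤n
  divisorBound-mono {2} {1}             (s≤s ())
  divisorBound-mono {2} {2}             _                   = ≤-refl
  divisorBound-mono {2} {suc (suc (suc j))} _               = s≤s z≤n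
  divisorBound-mono {suc (suc (suc i))} {suc (suc (suc j))} (s≤s (s≤s (s≤s i≤j))) = s≤s i≤j

  divisorBound<pred : ∀ {g n} → 3 ≤ n → g ≤ n → divisorBound g < pred n
  divisorBound<pred {n = suc (suc (suc j))} (s≤s (s≤s (s≤s _))) g≤n = s≤s (divisorBound-mono {b = suc (suc (suc j))} g≤n)

  divisorBound-gcd<ˡ : ∀ a b → divisorBound (gcd (suc a) b) < suc a
  divisorBound-gcd<ˡ a b = s≤s (≤-trans (divisorBound-≤ _) (pred-mono-≤ (∣⇒≤ (gcd[m,n]∣m (suc a) b))))

  divisorBound-gcd<ʳ : ∀ a b → divisorBound (gcd a (suc b)) < suc b
  divisorBound-gcd<ʳ a b = s≤s (≤-trans (divisorBound-≤ _) (pred-mono-≤ (∣⇒≤ (gcd[m,n]∣n a (suc b)))))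

  gap-zero : ∀ N c₁ {c₂} → c₁ < pred N → c₂ ≡ 0 → GapAt N 0 c₁ c₂
  gap-zero N c c<pred refl = begin-strict
    1 * c * q + (N + 0) * 0 * p ≡⟨ drop-zeros c q N p ⟩
    c * q                       <⟨ *-monoˡ-< q {{halfBinom-nonZero N 1}} c<pred ⟩
    pred N * q                 ≡⟨ cong (pred N *_) (trans (cong (_* q) (binom-0ʳ (upperHalf N))) (*-identityˡ q)) ⟨
    pred N * (p * q)           ∎
    where
    open ≤-Reasoning
    p = halfBinom N 0
    q = halfBinom N 1
    drop-zeros : ∀ c q N p → 1 * c * q + (N + 0) * 0 * p ≡ c * q
    drop-zeros = solve-∀

  4*upperHalf*upperHalf : ∀ m n → m * n ≤ 4 * (upperHalf n * upperHalf m)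
  4*upperHalf*upperHalf m n = begin
    m * n                                   ≤⟨ *-mono-≤ (n≤2*upperHalf m) (n≤2*upperHalf n) ⟩
    (2 * upperHalf m) * (2 * upperHalf n)   ≡⟨ regroup (upperHalf m) (upperHalf n) ⟩
    4 * (upperHalf n * upperHalf m)         ∎
    where
    open ≤-Reasoning
    regroup : ∀ a b → (2 * a) * (2 * b) ≡ 4 * (b * a)
    regroup = solve-∀

  suc*c≤4*halfBinom : ∀ N m c → c < N → c < m → suc m * c ≤ 4 * halfBinom N m
  suc*c≤4*halfBinom N m c c<N c<m = begin
    c + m * c                          ≤⟨ +-monoˡ-≤ (m * c) (<⇒≤ c<m) ⟩
    m + m * c                          ≡⟨ *-suc m c ⟨
    m * suc c                          ≤⟨ *-monoʳ-≤ m c<N ⟩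
    m * N                              ≤⟨ 4*upperHalf*upperHalf m N ⟩
    4 * (upperHalf N * upperHalf m)    ≤⟨ *-monoʳ-≤ 4 (≤-trans (n≤1+n _) (1+x*y≤binom (upperHalf N) (upperHalf m))) ⟩
    4 * halfBinom N m                  ∎
    where open ≤-Reasoning

  +*c<8*halfBinom : ∀ N m c → c < N → c ≤ m → (N + m) * c < 8 * halfBinom N (suc m)
  +*c<8*halfBinom N m c c<N c≤m = begin-strict
    (N + m) * c                                    ≡⟨ *-distribʳ-+ c N m ⟩
    N * c + m * c                                  ≤⟨ +-mono-≤ (*-monoʳ-≤ N (m≤n⇒m≤1+n c≤m)) (*-mono-≤ (n≤1+n m) (<⇒≤ c<N)) ⟩
    N * suc m + suc m * N                          ≤⟨ +-mono-≤ (4*upperHalf*upperHalf N (suc m)) (4*upperHalf*upperHalf (suc m) N) ⟩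
    4 * (u′ * u) + 4 * (u * u′)                    ≡⟨ regroup u u′ ⟩
    8 * (u * u′)                                   <⟨ *-monoʳ-< 8 (1+x*y≤binom u u′) ⟩
    8 * halfBinom N (suc m)                        ∎
    where
    open ≤-Reasoning
    u = upperHalf N
    u′ = upperHalf (suc m)
    regroup : ∀ a b → 4 * (b * a) + 4 * (a * b) ≡ 8 * (a * b)
    regroup = solve-∀

  gap-large-N : ∀ N m c₁ c₂ → 13 ≤ N → c₁ < N → c₁ < m → c₂ < N → c₂ ≤ m → GapAt N m c₁ c₂
  gap-large-N N m c₁ c₂ 13≤N c₁<N c₁<m c₂<N c₂≤m = begin-strict
    suc m * c₁ * q + (N + m) * c₂ * p ≤⟨ +-mono-≤ (*-monoˡ-≤ q (suc*c≤4*halfBinom N m c₁ c₁<N c₁<m)) ≤-refl ⟩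
    4 * p * q + (N + m) * c₂ * p       <⟨ +-monoʳ-< (4 * p * q) (*-monoˡ-< p {{halfBinom-nonZero N m}} (+*c<8*halfBinom N m c₂ c₂<N c₂≤m)) ⟩
    4 * p * q + 8 * q * p              ≡⟨ regroup p q ⟩
    12 * (p * q)                       ≤⟨ *-monoˡ-≤ (p * q) (pred-mono-≤ 13≤N) ⟩
    pred N * (p * q)                  ∎
    where
    open ≤-Reasoning
    p = halfBinom N m
    q = halfBinom N (suc m)
    regroup : ∀ a b → 4 * a * b + 8 * b * a ≡ 12 * (a * b)
    regroup = solve-∀

  48+8*v<[1+v]*[2+v] : ∀ {v} → 10 ≤ v → 48 + 8 * v < suc v * suc (suc v)
  48+8*v<[1+v]*[2+v] {v} 10≤v = subst (λ v → 48 + 8 * v < suc v * suc (suc v)) (m∸n+n≡m 10≤v) (shifted (v ∸ 10))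
    where
    expand : ∀ t → suc (48 + 8 * (t + 10)) + (3 + 15 * t + t * t) ≡ suc (t + 10) * suc (suc (t + 10))
    expand = solve-∀
    shifted : ∀ t → 48 + 8 * (t + 10) < suc (t + 10) * suc (suc (t + 10))
    shifted t = ≤-trans (m≤m+n _ (3 + 15 * t + t * t)) (≤-reflexive (expand t))

  48+8*upperHalf<2*halfBinom : ∀ N m → 3 ≤ N → 19 ≤ m → 48 + 8 * upperHalf m < 2 * halfBinom N m
  48+8*upperHalf<2*halfBinom N m 3≤N 19≤m = begin-strict
    48 + 8 * v                <⟨ 48+8*v<[1+v]*[2+v] (upperHalf-> {9} {m} 19≤m) ⟩
    suc v * suc (suc v)       ≡⟨ 2*binom-2ˡ v ⟨
    2 * binom 2 v             ≤⟨ *-monoʳ-≤ 2 (binom-mono-≤ (upperHalf-> {1} {N} 3≤N) ≤-refl) ⟩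
    2 * halfBinom N m         ∎
    where
    open ≤-Reasoning
    v = upperHalf m

  2*suc<halfBinom : ∀ N m → 3 ≤ N → 19 ≤ m → 2 * suc m < halfBinom N m
  2*suc<halfBinom N m 3≤N 19≤m = *-cancelˡ-< 2 (2 * suc m) (halfBinom N m) (begin-strict
    2 * (2 * suc m)           ≡⟨ regroup m ⟩
    4 + 4 * m                 ≤⟨ +-monoʳ-≤ 4 (*-monoʳ-≤ 4 (n≤2*upperHalf m)) ⟩
    4 + 4 * (2 * v)           ≤⟨ +-mono-≤ (m≤m+n 4 44) (≤-reflexive (sym (*-assoc 4 2 v))) ⟩
    48 + 8 * v                <⟨ 48+8*upperHalf<2*halfBinom N m 3≤N 19≤m ⟩
    2 * halfBinom N m         ∎)
    where
    open ≤-Reasoning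
    v = upperHalf m
    regroup : ∀ m → 2 * (2 * suc m) ≡ 4 + 4 * m
    regroup = solve-∀

  2*+<halfBinom-suc : ∀ N m → 3 ≤ N → N ≤ 13 → 19 ≤ m → 2 * (N + m) < halfBinom N (suc m)
  2*+<halfBinom-suc N m 3≤N N≤13 19≤m = *-cancelˡ-< 2 (2 * (N + m)) (halfBinom N (suc m)) (begin-strict
    2 * (2 * (N + m))         ≤⟨ +-cancelʳ-≤ 4 _ _ (begin
        2 * (2 * (N + m)) + 4     ≡⟨ regroup N m ⟩
        4 * N + 4 * suc m         ≤⟨ +-mono-≤ (*-monoʳ-≤ 4 N≤13) (*-monoʳ-≤ 4 (n≤2*upperHalf (suc m))) ⟩
        52 + 4 * (2 * v)          ≡⟨ shift v ⟩
        48 + 8 * v + 4            ∎) ⟩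
    48 + 8 * v                <⟨ 48+8*upperHalf<2*halfBinom N (suc m) 3≤N (m≤n⇒m≤1+n 19≤m) ⟩
    2 * halfBinom N (suc m)   ∎)
    where
    open ≤-Reasoning
    v = upperHalf (suc m)
    regroup : ∀ n m → 2 * (2 * (n + m)) + 4 ≡ 4 * n + 4 * suc m
    regroup = solve-∀
    shift : ∀ v → 52 + 4 * (2 * v) ≡ 48 + 8 * v + 4
    shift = solve-∀

  gap-large-m : ∀ N m c₁ c₂ → 3 ≤ N → N ≤ 13 → 19 ≤ m → c₁ ≤ pred N → c₂ ≤ pred N → GapAt N m c₁ c₂
  gap-large-m N m c₁ c₂ 3≤N N≤13 19≤m c₁≤ c₂≤ = begin-strict
    suc m * c₁ * q + (N + m) * c₂ * p  ≤⟨ +-mono-≤ (*-monoˡ-≤ q (*-monoʳ-≤ (suc m) c₁≤)) (*-monoˡ-≤ p (*-monoʳ-≤ (N + m) c₂≤)) ⟩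
    suc m * K * q + (N + m) * K * p    ≡⟨ factor (suc m) K q (N + m) p ⟩
    K * (suc m * q + (N + m) * p)      <⟨ *-monoʳ-< K {{>-nonZero (≤-trans (s≤s z≤n) (pred-mono-≤ 3≤N))}} weighted<pq ⟩
    K * (p * q)                        ∎
    where
    open ≤-Reasoning
    K = pred N
    p = halfBinom N m
    q = halfBinom N (suc m)
    factor : ∀ a k p b q → a * k * p + b * k * q ≡ k * (a * p + b * q)
    factor = solve-∀
    weighted<pq : suc m * q + (N + m) * p < p * q
    weighted<pq = *-cancelˡ-< 2 _ _ (begin-strict
      2 * (suc m * q + (N + m) * p)        ≡⟨ regroup (suc m) q (N + m) p ⟩
      (2 * suc m) * q + (2 * (N + m)) * p  <⟨ +-mono-<-≤ (*-monoˡ-< q {{halfBinom-nonZero N (suc m)}} (2*suc<halfBinom N m 3≤N 19≤m))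
                                                           (*-monoˡ-≤ p (<⇒≤ (2*+<halfBinom-suc N m 3≤N N≤13 19≤m))) ⟩
      p * q + q * p                        ≡⟨ double p q ⟩
      2 * (p * q)                          ∎)
      where
      regroup : ∀ a q b p → 2 * (a * q + b * p) ≡ (2 * a) * q + (2 * b) * p
      regroup = solve-∀
      double : ∀ a b → a * b + b * a ≡ 2 * (a * b)
      double = solve-∀

  binom≡!/!*! : ∀ x y → binom x y ≡ ((x + y) ! / (x ! * y !)) {{x !* y !≢0}}
  binom≡!/!*! x y = sym (trans (cong (λ z → (z / (x ! * y !)) {{x !* y !≢0}}) (sym (binom-*-! x y)))
                              (m*n/n≡m (binom x y) (x ! * y !) {{x !* y !≢0}}))

  all-upTo : ∀ (p : ℕ → Bool) {n i} → T (all p (upTo n)) → i < n → T (p i)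
  all-upTo p {n} t i<n = lookup (all⁺ p (upTo n) t) (∈-upTo⁺ i<n)

  -- Checked by evaluation, with binomials computed from factorials: the Pascal recursion is exponential.
  gap-small : ∀ {k m} → k < 10 → m < 19 →
              GapAt (3 + k) m (divisorBound (gcd (3 + k) m)) (divisorBound (gcd (3 + k) (suc m)))
  gap-small {k} {m} k<10 m<19 =
    subst₂ (Gap (3 + k) m (divisorBound (gcd (3 + k) m)) (divisorBound (gcd (3 + k) (suc m))))
      (sym (binom≡!/!*! (upperHalf (3 + k)) (upperHalf m))) (sym (binom≡!/!*! (upperHalf (3 + k)) (upperHalf (suc m))))
      (<ᵇ⇒< _ _ (all-upTo (gapᵇ (3 + k)) (all-upTo (λ k → all (gapᵇ (3 + k)) (upTo 19)) table k<10) m<19))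
    where
    binom! : ℕ → ℕ → ℕ
    binom! x y = ((x + y) ! / (x ! * y !)) {{x !* y !≢0}}
    gapᵇ : ℕ → ℕ → Bool
    gapᵇ N m = suc m * c₁ * q + (N + m) * c₂ * p <ᵇ pred N * (p * q)
      where
      c₁ = divisorBound (gcd N m)
      c₂ = divisorBound (gcd N (suc m))
      p = binom! (upperHalf N) (upperHalf m)
      q = binom! (upperHalf N) (upperHalf (suc m))
    table : T (all (λ k → all (gapᵇ (3 + k)) (upTo 19)) (upTo 10))
    table = _

  gap : ∀ N m → 3 ≤ N → GapAt N m (divisorBound (gcd N m)) (divisorBound (gcd N (suc m)))
  gap _ zero 3≤N@(s≤s (s≤s (s≤s {n = k} _))) =
    gap-zero N _ (divisorBound<pred 3≤N (∣⇒≤ (gcd[m,n]∣m N 0))) (n≤0⇒n≡0 (≤-pred (divisorBound-gcd<ʳ N 0)))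
    where N = 3 + k
  gap _ m@(suc j) 3≤N@(s≤s (s≤s (s≤s {n = k} _))) with 10 ≤? k | 19 ≤? m
  ... | yes 10≤k | _ =
    gap-large-N N m _ _ (+-monoʳ-≤ 3 10≤k) (divisorBound-gcd<ˡ (2 + k) m) (divisorBound-gcd<ʳ N j)
                                          (divisorBound-gcd<ˡ (2 + k) (suc m)) (≤-pred (divisorBound-gcd<ʳ N m))
    where N = 3 + k
  ... | no k≱10 | yes 19≤m =
    gap-large-m N m _ _ 3≤N (+-monoʳ-≤ 3 (<⇒≤ (≰⇒> k≱10))) 19≤m
                (≤-pred (divisorBound-gcd<ˡ (2 + k) m)) (≤-pred (divisorBound-gcd<ˡ (2 + k) (suc m)))
    where N = 3 + k
  ... | no k≱10 | no m≱19 = gap-small (≰⇒> k≱10) (≰⇒> m≱19)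

  gap-trivial : ∀ N m → 2 ≤ N → GapAt N m 0 0
  gap-trivial N m 2≤N = begin-strict
    suc m * 0 * q + (N + m) * 0 * p ≡⟨ vanish (suc m) q (N + m) p ⟩
    0                               <⟨ >-nonZero⁻¹ (pred N * (p * q)) {{m*n≢0 (pred N) (p * q) {{>-nonZero (pred-mono-≤ 2≤N)}} {{pq≢0}}}} ⟩
    pred N * (p * q)                ∎
    where
    open ≤-Reasoning
    p = halfBinom N m
    q = halfBinom N (suc m)
    pq≢0 = m*n≢0 p q {{halfBinom-nonZero N m}} {{halfBinom-nonZero N (suc m)}}
    vanish : ∀ a q b p → a * 0 * q + b * 0 * p ≡ 0
    vanish = solve-∀

module Signs where

  open import Data.Nat using (zero; suc)
  open import Data.Integer using (+_; -[1+_])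
  open import Data.Rational as ℚ using (ℚ; mkℚ; 0ℚ; 1ℚ; ∣_∣; _+_; _*_; _-_; -_; _≤_)
  import Data.Rational.Properties as ℚ
  open import Data.Rational.Solver using (module +-*-Solver)
  open import Data.Bool using (true; false)
  open import Data.List using (length)
  open import Data.Product using (_×_; _,_; proj₁; proj₂)
  open import Relation.Binary.PropositionalEquality
  open import Defs using (neg1^; μ; squarefree; primeDivisors)
  open +-*-Solver using (solve; _:+_; _:*_; :-_; _:-_; _:=_)

  p≤∣p∣ : ∀ p → p ≤ ∣ p ∣
  p≤∣p∣ (mkℚ (+ _)    _ _) = ℚ.≤-refl
  p≤∣p∣ p@(mkℚ -[1+ _ ] _ _) = ℚ.<⇒≤ (ℚ.neg<pos p ∣ p ∣)

  ∣p∣≤q⇒-q≤p≤q : ∀ {p q} → ∣ p ∣ ≤ q → (- q ≤ p) × (p ≤ q)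
  ∣p∣≤q⇒-q≤p≤q {p} {q} ∣p∣≤q =
    subst (- q ≤_) (neg-involutive p) (ℚ.neg-antimono-≤ (ℚ.≤-trans (p≤∣p∣ (- p)) (subst (_≤ q) (sym (ℚ.∣-p∣≡∣p∣ p)) ∣p∣≤q))) ,
    ℚ.≤-trans (p≤∣p∣ p) ∣p∣≤q
    where
    neg-involutive : ∀ x → - (- x) ≡ x
    neg-involutive = solve 1 (λ x → :- (:- x) := x) refl

  neg1^-*-neg1^ : ∀ t → neg1^ t * neg1^ t ≡ 1ℚ
  neg1^-*-neg1^ zero    = refl
  neg1^-*-neg1^ (suc t) = trans (neg-*-neg (neg1^ t)) (neg1^-*-neg1^ t)
    where
    neg-*-neg : ∀ x → (- x) * (- x) ≡ x * x
    neg-*-neg = solve 1 (λ x → (:- x) :* (:- x) := x :* x) refl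

  ∣neg1^∣ : ∀ t → ∣ neg1^ t ∣ ≡ 1ℚ
  ∣neg1^∣ zero    = refl
  ∣neg1^∣ (suc t) = trans (ℚ.∣-p∣≡∣p∣ (neg1^ t)) (∣neg1^∣ t)

  ∣μ∣≤1 : ∀ d → ∣ μ d ∣ ≤ 1ℚ
  ∣μ∣≤1 d with squarefree d
  ... | true  = ℚ.≤-reflexive (∣neg1^∣ (length (primeDivisors d)))
  ... | false = ℚ.<⇒≤ (ℚ.positive⁻¹ 1ℚ)

  sign-sandwich : ∀ {s D F e} a → 0ℚ ≤ a → s * s ≡ 1ℚ → ∣ s ∣ ≡ 1ℚ → ∣ D - s * F ∣ ≤ e →
                  (a * (F - e) ≤ (s * a) * D) × ((s * a) * D ≤ a * (F + e))
  sign-sandwich {s} {D} {F} {e} a 0≤a s²≡1 ∣s∣≡1 ∣D-sF∣≤e =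
    subst (a * (F - e) ≤_) scaled (ℚ.*-monoˡ-≤-nonNeg a {{ℚ.nonNegative 0≤a}} (ℚ.+-monoʳ-≤ F (proj₁ bounds))) ,
    subst (_≤ a * (F + e)) scaled (ℚ.*-monoˡ-≤-nonNeg a {{ℚ.nonNegative 0≤a}} (ℚ.+-monoʳ-≤ F (proj₂ bounds)))
    where
    sD-F≡s[D-sF] : s * D - F ≡ s * (D - s * F)
    sD-F≡s[D-sF] = begin
      s * D - F             ≡⟨ cong (λ w → s * D - w) (trans (cong (_* F) s²≡1) (ℚ.*-identityˡ F)) ⟨
      s * D - (s * s) * F   ≡⟨ factor s D F ⟩
      s * (D - s * F)       ∎
      where
      open ≡-Reasoning
      factor : ∀ s D F → s * D - (s * s) * F ≡ s * (D - s * F)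
      factor = solve 3 (λ s D F → s :* D :- (s :* s) :* F := s :* (D :- s :* F)) refl
    ∣sD-F∣≡∣D-sF∣ : ∣ s * D - F ∣ ≡ ∣ D - s * F ∣
    ∣sD-F∣≡∣D-sF∣ = trans (cong ∣_∣ sD-F≡s[D-sF])
      (trans (ℚ.∣p*q∣≡∣p∣*∣q∣ s (D - s * F)) (trans (cong (_* ∣ D - s * F ∣) ∣s∣≡1) (ℚ.*-identityˡ _)))
    bounds = ∣p∣≤q⇒-q≤p≤q {s * D - F} {e} (subst (_≤ e) (sym ∣sD-F∣≡∣D-sF∣) ∣D-sF∣≤e)
    scaled : a * (F + (s * D - F)) ≡ (s * a) * D
    scaled = solve 4 (λ a F s D → a :* (F :+ (s :* D :- F)) := (s :* a) :* D) refl a F s D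

module Separation where

  open import Data.Nat as ℕ using (suc; NonZero)
  import Data.Nat.Properties as ℕ
  open import Data.Nat.Tactic.RingSolver using (solve-∀)
  open import Data.Rational as ℚ using (ℚ; _+_; _*_; _-_; -_; _<_)
  import Data.Rational.Properties as ℚ
  open import Data.Rational.Solver using (module +-*-Solver)
  open import Relation.Binary.PropositionalEquality
  open Fraction
  open GapInequality using (Gap; gap⇒cross-multiplied)
  open +-*-Solver using (solve; _:+_; _:*_; _:-_; _:=_)

  upper<lower : ∀ {N m c₁ c₂ p q X Y n n′} .{{_ : NonZero p}} .{{_ : NonZero q}} .{{_ : NonZero n}} .{{_ : NonZero n′}} →
    n ≡ N ℕ.+ m → n′ ≡ suc n → 1 ℕ.≤ N → 1 ℕ.≤ Y → X ℕ.* suc (N ℕ.+ m) ≡ Y ℕ.* suc m → Gap N m c₁ c₂ p q →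
    frac 1 n * (frac X 1 + frac c₁ 1 * frac X p) < frac 1 n′ * (frac Y 1 - frac c₂ 1 * frac Y q)
  upper<lower {N} {m} {c₁} {c₂} {p} {q} {X} {Y} refl refl 1≤N 1≤Y Xn′≡Ym′ gap = begin-strict
    frac 1 n * (frac X 1 + frac c₁ 1 * frac X p)      ≡⟨ upper≡ ⟩
    frac (X ℕ.* (p ℕ.+ c₁)) (n ℕ.* p)                 <⟨ a+w<z⇒a<z-w sum< ⟩
    frac Y n′ - frac (c₂ ℕ.* Y) (n′ ℕ.* q)            ≡⟨ lower≡ ⟨
    frac 1 n′ * (frac Y 1 - frac c₂ 1 * frac Y q)     ∎
    where
    open ℚ.≤-Reasoning
    n = N ℕ.+ m
    n′ = suc n
    instance
      _ = ℕ.m*n≢0 n p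
      _ = ℕ.m*n≢0 n′ q
      _ = ℕ.m*n≢0 (n ℕ.* p) (n′ ℕ.* q)
    upper≡ : frac 1 n * (frac X 1 + frac c₁ 1 * frac X p) ≡ frac (X ℕ.* (p ℕ.+ c₁)) (n ℕ.* p)
    upper≡ = begin-equality
      frac 1 n * (frac X 1 + frac c₁ 1 * frac X p)    ≡⟨ cong (λ w → frac 1 n * (frac X 1 + w)) (frac-integer-* c₁ X p) ⟩
      frac 1 n * (frac X 1 + frac (c₁ ℕ.* X) p)       ≡⟨ cong (frac 1 n *_) (frac-integer-+ X (c₁ ℕ.* X) p) ⟩
      frac 1 n * frac (X ℕ.* p ℕ.+ c₁ ℕ.* X) p        ≡⟨ frac-unit-* n (X ℕ.* p ℕ.+ c₁ ℕ.* X) p ⟩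
      frac (X ℕ.* p ℕ.+ c₁ ℕ.* X) (n ℕ.* p)           ≡⟨ cong (λ z → frac z (n ℕ.* p)) (factor X p c₁) ⟩
      frac (X ℕ.* (p ℕ.+ c₁)) (n ℕ.* p)               ∎
      where
      factor : ∀ X p c → X ℕ.* p ℕ.+ c ℕ.* X ≡ X ℕ.* (p ℕ.+ c)
      factor = solve-∀
    lower≡ : frac 1 n′ * (frac Y 1 - frac c₂ 1 * frac Y q) ≡ frac Y n′ - frac (c₂ ℕ.* Y) (n′ ℕ.* q)
    lower≡ = begin-equality
      frac 1 n′ * (frac Y 1 - frac c₂ 1 * frac Y q)
        ≡⟨ distrib (frac 1 n′) (frac Y 1) (frac c₂ 1 * frac Y q) ⟩
      frac 1 n′ * frac Y 1 - frac 1 n′ * (frac c₂ 1 * frac Y q)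
        ≡⟨ cong₂ (λ u v → u - frac 1 n′ * v) (frac-unit-* n′ Y 1) (frac-integer-* c₂ Y q) ⟩
      frac Y (n′ ℕ.* 1) - frac 1 n′ * frac (c₂ ℕ.* Y) q
        ≡⟨ cong₂ _-_ (frac-cong Y (n′ ℕ.* 1) Y n′ (cong (Y ℕ.*_) (sym (ℕ.*-identityʳ n′)))) (frac-unit-* n′ (c₂ ℕ.* Y) q) ⟩
      frac Y n′ - frac (c₂ ℕ.* Y) (n′ ℕ.* q)
        ∎
      where
      distrib : ∀ a y w → a * (y - w) ≡ a * y - a * w
      distrib = solve 3 (λ a y w → a :* (y :- w) := a :* y :- a :* w) refl
    sum< : frac (X ℕ.* (p ℕ.+ c₁)) (n ℕ.* p) + frac (c₂ ℕ.* Y) (n′ ℕ.* q) < frac Y n′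
    sum< = subst (_< frac Y n′) (sym (frac-+ (X ℕ.* (p ℕ.+ c₁)) (n ℕ.* p) (c₂ ℕ.* Y) (n′ ℕ.* q)))
             (frac-mono-< (X ℕ.* (p ℕ.+ c₁) ℕ.* (n′ ℕ.* q) ℕ.+ c₂ ℕ.* Y ℕ.* (n ℕ.* p)) ((n ℕ.* p) ℕ.* (n′ ℕ.* q)) Y n′
               (gap⇒cross-multiplied {N} {m} {c₁} {c₂} {p} {q} {X} {Y} 1≤N 1≤Y Xn′≡Ym′ gap))
    a+w<z⇒a<z-w : ∀ {a w z} → a + w < z → a < z - w
    a+w<z⇒a<z-w {a} {w} {z} a+w<z = subst (_< z - w) (cancel a w) (ℚ.+-monoˡ-< (- w) a+w<z)
      where
      cancel : ∀ a w → a + w - w ≡ a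
      cancel = solve 2 (λ a w → a :+ w :- w := a) refl

module Monotonicity where

  open import Data.Nat as ℕ using (ℕ; suc; NonZero; _∸_)
  import Data.Nat.Properties as ℕ
  open import Data.Nat.Tactic.RingSolver using (solve-∀)
  open import Data.Nat.DivMod using (_/_; n/1≡n; +-distrib-/-∣ˡ; 0/n≡0)
  open import Data.Nat.Divisibility using (_∣_; ∣-refl; ∣-trans; ∣m∣n⇒∣m+n; _∣0; 0∣⇒≡0; 1∣_; ∣⇒≤)
  open import Data.Rational as ℚ using (ℚ; 0ℚ; 1ℚ; ∣_∣; _+_; _*_; _-_; _≤_; _<_)
  import Data.Rational.Properties as ℚ
  open import Data.List using (List; []; _∷_; _++_; _∷ʳ_; map; take)
  open import Data.List.Properties using (map-++; map-cong; map-id)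
  open import Data.List.Relation.Unary.All using (All; []; _∷_)
  import Data.List.Relation.Unary.All.Properties as All
  open import Data.Nat.ListAction using (sum)
  open import Data.Nat.ListAction.Properties using (sum-++)
  open import Data.Product using (_×_; _,_; proj₁; proj₂)
  open import Data.Sum using (_⊎_; inj₁; inj₂)
  open import Data.Nat.GCD using (gcd; gcd[m,n]∣m; gcd[m,n]∣n; gcd-greatest; gcd[m,n]≢0)
  open import Relation.Binary.PropositionalEquality
  open import Defs
  open Binomial
  open Multinomial
  open Fraction
  open DivisorSum
  open GapInequality
  open Signs
  open Separation

  ∣gcdL⇒All∣ : ∀ {d} xs → d ∣ gcdL xs → All (d ∣_) xs
  ∣gcdL⇒All∣ []       _   = []
  ∣gcdL⇒All∣ (x ∷ xs) d∣g = ∣-trans d∣g (gcd[m,n]∣m x (gcdL xs)) ∷ ∣gcdL⇒All∣ xs (∣-trans d∣g (gcd[m,n]∣n x (gcdL xs)))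

  All∣⇒∣sum : ∀ {d xs} → All (d ∣_) xs → d ∣ sum xs
  All∣⇒∣sum []           = _ ∣0
  All∣⇒∣sum (d∣x ∷ d∣xs) = ∣m∣n⇒∣m+n d∣x (All∣⇒∣sum d∣xs)

  sum-map-/ : ∀ {d} .{{_ : NonZero d}} {xs} → All (d ∣_) xs → sum (map (_/ d) xs) ≡ sum xs / d
  sum-map-/ {d} {[]}     []           = sym (0/n≡0 d)
  sum-map-/ {d} {x ∷ xs} (d∣x ∷ d∣xs) = trans (cong (x / d ℕ.+_) (sum-map-/ d∣xs)) (sym (+-distrib-/-∣ˡ (sum xs) d∣x))

  multiTerm≡multinomial : ∀ xs d .{{_ : NonZero d}} → All (d ∣_) xs → multiTerm xs d ≡ frac (multinomial (map (_/ d) xs)) 1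
  multiTerm≡multinomial xs d d∣xs = begin
    frac ((sum xs / d) ℕ.!) (prodFact ys)              ≡⟨ cong (λ s → frac (s ℕ.!) (prodFact ys)) (sum-map-/ d∣xs) ⟨
    frac (sum ys ℕ.!) (prodFact ys)                    ≡⟨ cong (λ s → frac s (prodFact ys)) (multinomial-*-prodFact ys) ⟨
    frac (multinomial ys ℕ.* prodFact ys) (prodFact ys) ≡⟨ frac-cong (multinomial ys ℕ.* prodFact ys) (prodFact ys) (multinomial ys) 1 (ℕ.*-identityʳ _) ⟩
    frac (multinomial ys) 1                            ∎
    where
    open ≡-Reasoning
    ys = map (_/ d) xs
    instance _ = prodFact≢0 ys

  gcdL-∷ʳ-∣-sum : ∀ xs m → gcdL (xs ∷ʳ m) ∣ sum xs
  gcdL-∷ʳ-∣-sum xs m = All∣⇒∣sum (All.++⁻ˡ xs (∣gcdL⇒All∣ (xs ∷ʳ m) ∣-refl))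

  gcdL-∷ʳ-∣ : ∀ xs m → gcdL (xs ∷ʳ m) ∣ m
  gcdL-∷ʳ-∣ xs m with All.++⁻ʳ xs (∣gcdL⇒All∣ (xs ∷ʳ m) ∣-refl)
  ... | g∣m ∷ [] = g∣m

  multinomial-map-/-∷ʳ : ∀ xs m d .{{_ : NonZero d}} → All (d ∣_) xs →
                         multinomial (map (_/ d) (xs ∷ʳ m)) ≡ binom (sum xs / d) (m / d) ℕ.* multinomial (map (_/ d) xs)
  multinomial-map-/-∷ʳ xs m d d∣xs = begin
    multinomial (map (_/ d) (xs ∷ʳ m))                                   ≡⟨ cong multinomial (map-++ (_/ d) xs (m ∷ [])) ⟩
    multinomial (map (_/ d) xs ∷ʳ m / d)                                 ≡⟨ multinomial-∷ʳ (map (_/ d) xs) (m / d) ⟩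
    binom (sum (map (_/ d) xs)) (m / d) ℕ.* multinomial (map (_/ d) xs)  ≡⟨ cong (λ s → binom s (m / d) ℕ.* multinomial (map (_/ d) xs)) (sum-map-/ d∣xs) ⟩
    binom (sum xs / d) (m / d) ℕ.* multinomial (map (_/ d) xs)           ∎
    where open ≡-Reasoning

  suc[n+m∸1]≡n+m : ∀ {n} m → 1 ℕ.≤ n → suc (n ℕ.+ m ∸ 1) ≡ n ℕ.+ m
  suc[n+m∸1]≡n+m {suc n} m _ = refl

  sandwiched⇒increasing : (f lo hi : ℕ → ℚ) → (∀ m → lo m ≤ f m × f m ≤ hi m) → (∀ m → hi m < lo (suc m)) → StrictlyIncreasing f
  sandwiched⇒increasing f lo hi sandwich hi<lo m =
    ℚ.≤-<-trans (proj₂ (sandwich m)) (ℚ.<-≤-trans (hi<lo m) (proj₁ (sandwich (suc m))))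

  module Estimates (L : List ℕ) (1≤N : 1 ℕ.≤ sum L) where

    N : ℕ
    N = sum L

    G : ℕ → ℕ
    G m = gcdL (L ∷ʳ m)

    X : ℕ → ℕ
    X m = binom N m ℕ.* multinomial L

    G-nonZero : ∀ m → NonZero (G m)
    G-nonZero m = ℕ.≢-nonZero λ G≡0 → ℕ.<⇒≢ 1≤N (sym (0∣⇒≡0 (subst (_∣ N) G≡0 (gcdL-∷ʳ-∣-sum L m))))

    F B : ℕ → ℚ
    F m = frac (X m) 1
    B m = frac (X m) (halfBinom N m) {{halfBinom-nonZero N m}}

    -- The denominator of M and V at L ∷ʳ m, literally as in their definitions.
    n : ℕ → ℕ
    n m = suc (sum (L ∷ʳ m) ∸ 1)

    n≡N+m : ∀ m → n m ≡ N ℕ.+ m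
    n≡N+m m = trans (cong (λ s → suc (s ∸ 1)) (trans (sum-++ L (m ∷ [])) (cong (N ℕ.+_) (ℕ.+-identityʳ m)))) (suc[n+m∸1]≡n+m m 1≤N)

    lower upper : ℕ → ℕ → ℚ
    lower m c = frac 1 (n m) * (F m - frac c 1 * B m)
    upper m c = frac 1 (n m) * (F m + frac c 1 * B m)

    multiTerm-1 : ∀ m → multiTerm (L ∷ʳ m) 1 ≡ F m
    multiTerm-1 m = begin
      multiTerm (L ∷ʳ m) 1                      ≡⟨ multiTerm≡multinomial (L ∷ʳ m) 1 (∣gcdL⇒All∣ (L ∷ʳ m) (1∣ G m)) ⟩
      frac (multinomial (map (_/ 1) (L ∷ʳ m))) 1 ≡⟨ cong (λ xs → frac (multinomial xs) 1) (trans (map-cong n/1≡n (L ∷ʳ m)) (map-id (L ∷ʳ m))) ⟩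
      frac (multinomial (L ∷ʳ m)) 1              ≡⟨ cong (λ z → frac z 1) (multinomial-∷ʳ L m) ⟩
      F m                                        ∎
      where open ≡-Reasoning

    multiTerm≤B : ∀ m d .{{_ : NonZero d}} → 2 ℕ.≤ d → d ∣ G m → multiTerm (L ∷ʳ m) d ≤ B m
    multiTerm≤B m d 2≤d d∣G = subst (_≤ B m) (sym (multiTerm≡multinomial (L ∷ʳ m) d d∣L∷ʳm))
      (frac-mono-≤ (multinomial (map (_/ d) (L ∷ʳ m))) 1 (X m) (halfBinom N m) {{_}} {{halfBinom-nonZero N m}} (begin
        multinomial (map (_/ d) (L ∷ʳ m)) ℕ.* halfBinom N m
          ≡⟨ cong (ℕ._* halfBinom N m) (multinomial-map-/-∷ʳ L m d d∣L) ⟩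
        binom (N / d) (m / d) ℕ.* multinomial (map (_/ d) L) ℕ.* halfBinom N m
          ≡⟨ swap (binom (N / d) (m / d)) (multinomial (map (_/ d) L)) (halfBinom N m) ⟩
        binom (N / d) (m / d) ℕ.* halfBinom N m ℕ.* multinomial (map (_/ d) L)
          ≤⟨ ℕ.*-mono-≤ (binom-/-*-halfBinom≤binom N m d 2≤d) (multinomial-map-/-≤ L d) ⟩
        X m
          ≡⟨ ℕ.*-identityʳ (X m) ⟨
        X m ℕ.* 1
          ∎))
      where
      open ℕ.≤-Reasoning
      d∣L∷ʳm = ∣gcdL⇒All∣ (L ∷ʳ m) d∣G
      d∣L = All.++⁻ˡ L d∣L∷ʳm
      swap : ∀ x y z → x ℕ.* y ℕ.* z ≡ x ℕ.* z ℕ.* y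
      swap = solve-∀

    weighted-divSum-bound : ∀ m (w : Weight) → (∀ d .{{_ : NonZero d}} → ∣ w d ∣ ≤ 1ℚ) →
      ∣ divSum (G m) (λ d → w d * multiTerm (L ∷ʳ m) d) - w 1 * F m ∣ ≤ frac (divisorBound (G m)) 1 * B m
    weighted-divSum-bound m w ∣w∣≤1 =
      subst (λ z → ∣ divSum (G m) f - w 1 * z ∣ ≤ frac (divisorBound (G m)) 1 * B m) (multiTerm-1 m)
        (divSum-bound (G m) {{G-nonZero m}} f (frac-nonNeg (X m) (halfBinom N m) {{halfBinom-nonZero N m}}) term≤B)
      where
      f : Weight
      f d = w d * multiTerm (L ∷ʳ m) d
      term≤B : ∀ k → suc (suc k) ∣ G m → ∣ f (suc (suc k)) ∣ ≤ B m
      term≤B k d∣G = begin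
        ∣ w d * t ∣       ≡⟨ ℚ.∣p*q∣≡∣p∣*∣q∣ (w d) t ⟩
        ∣ w d ∣ * ∣ t ∣   ≡⟨ cong (∣ w d ∣ *_) (ℚ.0≤p⇒∣p∣≡p 0≤t) ⟩
        ∣ w d ∣ * t       ≤⟨ ℚ.*-monoʳ-≤-nonNeg t {{ℚ.nonNegative 0≤t}} (∣w∣≤1 d) ⟩
        1ℚ * t            ≡⟨ ℚ.*-identityˡ t ⟩
        t                 ≤⟨ multiTerm≤B m d (ℕ.s≤s (ℕ.s≤s ℕ.z≤n)) d∣G ⟩
        B m               ∎
        where
        open ℚ.≤-Reasoning
        d = suc (suc k)
        t = multiTerm (L ∷ʳ m) d
        0≤t : 0ℚ ≤ t
        0≤t = frac-nonNeg ((sum (L ∷ʳ m) / d) ℕ.!) (prodFact (map (_/ d) (L ∷ʳ m))) {{prodFact≢0 (map (_/ d) (L ∷ʳ m))}}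

    sandwich : ∀ m (w : Weight) s → w 1 ≡ s → s * s ≡ 1ℚ → ∣ s ∣ ≡ 1ℚ → (∀ d .{{_ : NonZero d}} → ∣ w d ∣ ≤ 1ℚ) →
      let x = (s * frac 1 (n m)) * divSum (G m) (λ d → w d * multiTerm (L ∷ʳ m) d)
          c = divisorBound (G m)
      in lower m c ≤ x × x ≤ upper m c
    sandwich m w s w1≡s s²≡1 ∣s∣≡1 ∣w∣≤1 =
      sign-sandwich (frac 1 (n m)) (frac-nonNeg 1 (n m)) s²≡1 ∣s∣≡1
        (subst (λ z → ∣ D - z * F m ∣ ≤ frac (divisorBound (G m)) 1 * B m) w1≡s (weighted-divSum-bound m w ∣w∣≤1))
      where D = divSum (G m) (λ d → w d * multiTerm (L ∷ʳ m) d)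

    M-sandwich : ∀ m → lower m (divisorBound (G m)) ≤ M (L ∷ʳ m) × M (L ∷ʳ m) ≤ upper m (divisorBound (G m))
    M-sandwich m = subst (λ a → lower m c ≤ a * D × a * D ≤ upper m c) (ℚ.*-identityˡ (frac 1 (n m)))
                     (sandwich m (λ d → μ d) 1ℚ refl refl refl (λ d → ∣μ∣≤1 d))
      where
      c = divisorBound (G m)
      D = divSum (G m) (λ d → μ d * multiTerm (L ∷ʳ m) d)

    V-sandwich : ∀ k m → lower m (divisorBound (G m)) ≤ V k (L ∷ʳ m) × V k (L ∷ʳ m) ≤ upper m (divisorBound (G m))
    V-sandwich k m = sandwich m (λ d → μ d * neg1^ (t / d)) (neg1^ t) (trans (ℚ.*-identityˡ _) (cong neg1^ (n/1≡n t)))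
                       (neg1^-*-neg1^ t) (∣neg1^∣ t) ∣w∣≤1
      where
      t = sum (take k (L ∷ʳ m))
      ∣w∣≤1 : ∀ d .{{_ : NonZero d}} → ∣ μ d * neg1^ (t / d) ∣ ≤ 1ℚ
      ∣w∣≤1 d = ℚ.≤-trans (ℚ.≤-reflexive (trans (ℚ.∣p*q∣≡∣p∣*∣q∣ (μ d) _) (trans (cong (∣ μ d ∣ *_) (∣neg1^∣ (t / d))) (ℚ.*-identityʳ _))))
                          (∣μ∣≤1 d)

    upper<lower-suc : ∀ m {c₁ c₂} → GapAt N m c₁ c₂ → upper m c₁ < lower (suc m) c₂
    upper<lower-suc m {c₁} {c₂} gap =
      upper<lower {N} {m} {c₁} {c₂} {halfBinom N m} {halfBinom N (suc m)} {X m} {X (suc m)} {n m} {n (suc m)}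
        {{halfBinom-nonZero N m}} {{halfBinom-nonZero N (suc m)}} (n≡N+m m) n-suc 1≤N
        (ℕ.*-mono-≤ (binom-pos N (suc m)) (multinomial-pos L)) X-suc gap
      where
      n-suc : n (suc m) ≡ suc (n m)
      n-suc = trans (n≡N+m (suc m)) (trans (ℕ.+-suc N m) (cong suc (sym (n≡N+m m))))
      X-suc : X m ℕ.* suc (N ℕ.+ m) ≡ X (suc m) ℕ.* suc m
      X-suc = begin
        binom N m ℕ.* φ ℕ.* suc (N ℕ.+ m)     ≡⟨ regroup (binom N m) φ (suc (N ℕ.+ m)) ⟩
        suc (N ℕ.+ m) ℕ.* binom N m ℕ.* φ     ≡⟨ cong (ℕ._* φ) (binom-sucʳ N m) ⟨
        binom N (suc m) ℕ.* suc m ℕ.* φ       ≡⟨ regroup′ (binom N (suc m)) (suc m) φ ⟩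
        binom N (suc m) ℕ.* φ ℕ.* suc m       ∎
        where
        open ≡-Reasoning
        φ = multinomial L
        regroup : ∀ b f s → b ℕ.* f ℕ.* s ≡ s ℕ.* b ℕ.* f
        regroup = solve-∀
        regroup′ : ∀ b s f → b ℕ.* s ℕ.* f ≡ b ℕ.* f ℕ.* s
        regroup′ = solve-∀

    increasing : (∀ m → GapAt N m (divisorBound (G m)) (divisorBound (G (suc m)))) →
                 StrictlyIncreasing (λ m → M (L ∷ʳ m)) × (∀ k → StrictlyIncreasing (λ m → V k (L ∷ʳ m)))
    increasing gaps =
      sandwiched⇒increasing _ _ _ M-sandwich hi<lo ,
      λ k → sandwiched⇒increasing _ _ _ (V-sandwich k) hi<lo
      where
      hi<lo : ∀ m → upper m (divisorBound (G m)) < lower (suc m) (divisorBound (G (suc m)))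
      hi<lo m = upper<lower-suc m {divisorBound (G m)} {divisorBound (G (suc m))} (gaps m)

  divisorBound-gcdL-∷ʳ≤ : ∀ L m → 1 ℕ.≤ sum L → divisorBound (gcdL (L ∷ʳ m)) ℕ.≤ divisorBound (gcd (sum L) m)
  divisorBound-gcdL-∷ʳ≤ L m 1≤N =
    divisorBound-mono (∣⇒≤ {{gcd-nonZero}} (gcd-greatest (gcdL-∷ʳ-∣-sum L m) (gcdL-∷ʳ-∣ L m)))
    where
    gcd-nonZero : NonZero (gcd (sum L) m)
    gcd-nonZero = ℕ.≢-nonZero (gcd[m,n]≢0 (sum L) m (inj₁ (ℕ.≢-nonZero⁻¹ (sum L) {{ℕ.>-nonZero 1≤N}})))

  hypothesis⇒1≤sum : ∀ L → 3 ℕ.≤ sum L ⊎ L ≡ 1 ∷ 1 ∷ [] → 1 ℕ.≤ sum L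
  hypothesis⇒1≤sum L (inj₁ 3≤N)  = ℕ.≤-trans (ℕ.s≤s ℕ.z≤n) 3≤N
  hypothesis⇒1≤sum _ (inj₂ refl) = ℕ.s≤s ℕ.z≤n

  hypothesis⇒gaps : ∀ L → 3 ℕ.≤ sum L ⊎ L ≡ 1 ∷ 1 ∷ [] →
    ∀ m → GapAt (sum L) m (divisorBound (gcdL (L ∷ʳ m))) (divisorBound (gcdL (L ∷ʳ suc m)))
  hypothesis⇒gaps L h@(inj₁ 3≤N) m =
    GapAt-anti (sum L) m (divisorBound-gcdL-∷ʳ≤ L m 1≤N) (divisorBound-gcdL-∷ʳ≤ L (suc m) 1≤N) (gap (sum L) m 3≤N)
    where 1≤N = hypothesis⇒1≤sum L h
  hypothesis⇒gaps _ (inj₂ refl) m =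
    GapAt-anti 2 m (no-divisors m) (no-divisors (suc m)) (gap-trivial 2 m ℕ.≤-refl)
    where
    no-divisors : ∀ m → divisorBound (gcdL (1 ∷ 1 ∷ m ∷ [])) ℕ.≤ 0
    no-divisors m = divisorBound-mono (∣⇒≤ (gcd[m,n]∣m 1 (gcdL (1 ∷ m ∷ []))))

  StrictlyIncreasing-cong : ∀ {f g : ℕ → ℚ} → (∀ m → f m ≡ g m) → StrictlyIncreasing f → StrictlyIncreasing g
  StrictlyIncreasing-cong f≡g f↑ m = subst₂ _<_ (f≡g m) (f≡g (suc m)) (f↑ m)

open import Defs
open import Data.Nat using (ℕ; _≤_; _+_)
open import Data.Vec using (Vec; toList; _∷ʳ_)
open import Data.List using (List; []; _∷_)
open import Data.Nat.ListAction using (sum)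
open import Data.Product using (_×_)
open import Data.Sum using (_⊎_)
open import Relation.Binary.PropositionalEquality using (_≡_)

open import Data.Product using (_,_; proj₁; proj₂)
open import Data.Vec.Properties using (toList-∷ʳ)
open import Relation.Binary.PropositionalEquality using (cong; sym)
open Monotonicity using (module Estimates; hypothesis⇒1≤sum; hypothesis⇒gaps; StrictlyIncreasing-cong)

theorem6 : (r : ℕ) → 1 ≤ r → (ns : Vec ℕ r) →
    (3 ≤ sum (toList ns) ⊎ toList ns ≡ 1 ∷ 1 ∷ []) →
    StrictlyIncreasing (λ m → M (toList (ns ∷ʳ m)))
    × (∀ k → 1 ≤ k → k ≤ r + 1 → StrictlyIncreasing (λ m → V k (toList (ns ∷ʳ m))))
theorem6 r _ ns hyp =
  StrictlyIncreasing-cong (λ m → cong M (sym (toList-∷ʳ m ns))) (proj₁ L-increasing) ,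
  λ k _ _ → StrictlyIncreasing-cong (λ m → cong (V k) (sym (toList-∷ʳ m ns))) (proj₂ L-increasing k)
  where
  L = toList ns
  L-increasing = Estimates.increasing L (hypothesis⇒1≤sum L hyp) (hypothesis⇒gaps L hyp)
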